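{- Let $q$ be a power of an odd prime with $q\equiv 1\pmod 3$, and let $\zeta\in\mathbb{F}_q^{\ast}$ be an element of order $3$. Let $m,d$ be positive integers with $q-1=md$ and $d\equiv 0\pmod 3$. Let $u,v,w\in\mathbb{F}_q^{\ast}$ have multiplicative orders $m_0,m_1,m_2$ respectively, each dividing $m$, and write $n_i=m/m_i$ for $i=0,1,2$. Put $a=(u+v\zeta+w\zeta^2)/3$, $b=(u+v\zeta^2+w\zeta)/3$, $c=(u+v+w)/3$ and $f(x)=ax^{(2q+1)/3}+bx^{(q+2)/3}+cx$. Then: (i) $f$ is a permutation polynomial of $\mathbb{F}_q$; (ii) the permutation induced by $f$ has cycle type $1+m_0^{dn_0/3}+m_1^{dn_1/3}+m_2^{dn_2/3}$; (iii) the inverse permutation is induced by the trinomial $a'x^{(2q+1)/3}+b'x^{(q+2)/3}+c'x$, where $a'=(u^{ -1}+v^{ -1}\zeta+w^{ -1}\zeta^2)/3$, $b'=(u^{ -1}+v^{ -1}\zeta^2+w^{ -1}\zeta)/3$ and $c'=(u^{ -1}+v^{ -1}+w^{ -1})/3$.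
   Context: The order of a nonzero element means its order in $\mathbb{F}_q^{\ast}$. A cycle type $1+m_0^{k_0}+m_1^{k_1}+m_2^{k_2}$ means the permutation has exactly one fixed point and otherwise consists of $k_i$ disjoint cycles of length $m_i$ for $i=0,1,2$ (counts adding when some $m_i$ coincide). -}

module Defs where

open import Data.Nat as ℕ using (ℕ; zero; suc; _<_; _≤_)
open import Data.Fin as Fin using (Fin)
open import Data.Fin.Properties as FinP using ()
open import Data.Bool using (Bool; true; false; _∧_; not)
open import Data.List using (List; []; _∷_; filter; length; map; allFin)
open import Data.Bool.ListAction using (all)
open import Data.List.Base using (upTo)
open import Data.Product using (∃; _×_)
open import Relation.Nullary using (¬_)
open import Relation.Nullary.Decidable using (does)
open import Relation.Binary.PropositionalEquality using (_≡_; _≢_)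
open import Algebra.Structures using (IsCommutativeRing)
open import Function.Bundles using (_↔_; Inverse)
open import Function.Definitions using (Bijective)

record FiniteField (q : ℕ) : Set₁ where
  infixl 6 _+_
  infixl 7 _*_
  field
    Carrier : Set
    _+_     : Carrier → Carrier → Carrier
    _*_     : Carrier → Carrier → Carrier
    -_      : Carrier → Carrier
    0#      : Carrier
    1#      : Carrier
    isCommutativeRing : IsCommutativeRing _≡_ _+_ _*_ -_ 0# 1#
    0≢1     : 0# ≢ 1#
    inverse : ∀ x → x ≢ 0# → ∃ λ y → x * y ≡ 1#
    enum    : Carrier ↔ Fin q

  _^_ : Carrier → ℕ → Carrier
  x ^ zero  = 1#
  x ^ suc n = x * (x ^ n)

  HasOrder : Carrier → ℕ → Set
  HasOrder x k = (0 < k) × (x ^ k ≡ 1#) × (∀ j → 0 < j → x ^ j ≡ 1# → k ≤ j)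

  three : Carrier
  three = 1# + 1# + 1#

  _==_ : Carrier → Carrier → Bool
  x == y = does (Inverse.to enum x Fin.≟ Inverse.to enum y)

  elements : List Carrier
  elements = map (Inverse.from enum) (allFin q)

  iter : (Carrier → Carrier) → ℕ → Carrier → Carrier
  iter σ zero    x = x
  iter σ (suc k) x = σ (iter σ k x)

  -- x lies on a cycle of σ of length exactly L (L ≥ 1)
  hasPeriod : (Carrier → Carrier) → ℕ → Carrier → Bool
  hasPeriod σ L x = (iter σ L x == x) ∧ all (λ j → not (iter σ (suc j) x == x)) (upTo (L ℕ.∸ 1))

  numCycles : (Carrier → Carrier) → (L : ℕ) → .{{ℕ.NonZero L}} → ℕ
  numCycles σ L = length (filter (λ x → hasPeriod σ L x ≡ᵇ true) elements) ℕ./ L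
    where
      open import Data.Bool.Properties using () renaming (_≟_ to _≡ᵇ_)

δ : ℕ → ℕ → ℕ
δ a b with a ℕ.≟ b
... | Relation.Nullary.yes _ = 1
... | Relation.Nullary.no _  = 0

{-# OPTIONS --safe #-}
module Submission where

-- Write q = 3s + 1 and χ x = x ^ s.  By Fermat χ takes its values in {0, 1, ζ, ζ²}, and as
-- (2q + 1)/3 = 2s + 1 and (q + 2)/3 = s + 1 we get f x = (a χ(x)² + b χ(x) + c) x.  Since
-- (a, b, c) is the discrete Fourier transform of (u, v, w), f multiplies the class χ = 1 by u,
-- the class χ = ζ by v and the class χ = ζ² by w.  Each m_i divides s, so χ u = χ v = χ w = 1:
-- every class is invariant, the trinomial with inverted coefficients undoes f, and a point of
-- the class belonging to a multiplier of order m_i lies on a cycle of length m_i.  The three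
-- classes have s elements each, and s = m_i · (d n_i / 3) gives the cycle type.

open import Defs
open import Data.Nat as ℕ using (ℕ; zero; suc; _∸_; _/_; _%_; _≤_; NonZero)
import Data.Nat.Properties as ℕP
import Data.Nat.DivMod as ℕD
open import Data.Nat.Divisibility using (_∣_; divides)
import Data.Nat.Tactic.RingSolver as ℕSolver
open import Data.Nat.Primality using (Prime)
open import Data.Fin as Fin using (Fin; punchIn)
import Data.Fin.Properties as FinP
open import Data.Bool using (true; false; T; not; if_then_else_)
import Data.Bool.Properties as BoolP
open import Data.List.Base using ([]; _∷_; length; filter; tabulate)
open import Data.List.Properties using (map-tabulate)
open import Data.List.Relation.Unary.All.Properties using (all⁺; all⁻; applyUpTo⁺₁; applyUpTo⁻)
open import Data.Product using (Σ; ∃; ∃₂; _×_; _,_; proj₁; proj₂)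
open import Data.Sum using (_⊎_; inj₁; inj₂)
open import Data.Empty using (⊥-elim)
open import Function using (id; _∘_)
open import Function.Bundles using (Inverse; Equivalence)
open import Function.Definitions using (Bijective; Injective)
open import Function.Consequences.Propositional using (inverseᵇ⇒bijective; strictlyInverseˡ⇒inverseˡ; strictlyInverseʳ⇒inverseʳ)
open import Relation.Nullary using (¬_; Dec; yes; no; does)
open import Relation.Nullary.Decidable using (dec-true; dec-false)
open import Relation.Binary.PropositionalEquality
  using (_≡_; _≢_; refl; sym; trans; cong; cong₂; subst; module ≡-Reasoning)
open import Algebra.Bundles using (CommutativeMonoid; CommutativeRing)
open import Algebra.Structures using (IsCommutativeRing)
import Algebra.Properties.CommutativeMonoid.Sum as MonoidSum
open import Data.Fin.Permutation using (Permutation; permutation; _⟨$⟩ʳ_)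

indicator : ∀ {a} {A : Set a} → Dec A → ℕ
indicator a? = if does a? then 1 else 0

indicator-yes : ∀ {a} {A : Set a} (a? : Dec A) → A → indicator a? ≡ 1
indicator-yes (yes _) _ = refl
indicator-yes (no ¬a) a = ⊥-elim (¬a a)

indicator-no : ∀ {a} {A : Set a} (a? : Dec A) → ¬ A → indicator a? ≡ 0
indicator-no (yes a) ¬a = ⊥-elim (¬a a)
indicator-no (no _) _ = refl

indicator-cong : ∀ {a b} {A : Set a} {B : Set b} (a? : Dec A) (b? : Dec B) →
                 (A → B) → (B → A) → indicator a? ≡ indicator b?
indicator-cong (yes _) (yes _) _ _ = refl
indicator-cong (no _) (no _) _ _ = refl
indicator-cong (yes a) (no ¬b) f _ = ⊥-elim (¬b (f a))
indicator-cong (no ¬a) (yes b) _ g = ⊥-elim (¬a (g b))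

δ≡indicator : ∀ a b → δ a b ≡ indicator (a ℕ.≟ b)
δ≡indicator a b with a ℕ.≟ b
... | yes a≡b = sym (indicator-yes (a ℕ.≟ b) a≡b)
... | no a≢b = sym (indicator-no (a ℕ.≟ b) a≢b)

open MonoidSum ℕP.+-0-commutativeMonoid using (∑-distrib-+) renaming (sum to ∑; sum-cong-≗ to ∑-cong)

∑-*ˡ : ∀ {n} k (f : Fin n → ℕ) → ∑ (λ i → k ℕ.* f i) ≡ k ℕ.* ∑ f
∑-*ˡ k f = sym (*-distribˡ-sum k f)
  where open import Algebra.Properties.Semiring.Sum ℕP.+-*-semiring using (*-distribˡ-sum)

∑-ones : ∀ n → ∑ {n} (λ _ → 1) ≡ n
∑-ones zero = refl
∑-ones (suc n) = cong suc (∑-ones n)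

length-filter-tabulate : ∀ {a p} {A : Set a} {P : A → Set p} (P? : ∀ x → Dec (P x)) {n} (h : Fin n → A) →
                         length (filter P? (tabulate h)) ≡ ∑ (λ i → indicator (P? (h i)))
length-filter-tabulate P? {zero} h = refl
length-filter-tabulate P? {suc n} h with does (P? (h Fin.zero))
... | true = cong suc (length-filter-tabulate P? (h ∘ Fin.suc))
... | false = length-filter-tabulate P? (h ∘ Fin.suc)

module _ {c ℓ} (M : CommutativeMonoid c ℓ) where
  open CommutativeMonoid M using (Carrier; _≈_; _∙_; ∙-congˡ; setoid)
  open MonoidSum M using (sum; sum-remove; sum-cong-≋)
  open import Relation.Binary.Reasoning.Setoid setoid

  sum-constExcept : ∀ {n} (t : Fin n → Carrier) i {b} → (∀ j → j ≢ i → t j ≈ b) →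
                    sum t ≈ t i ∙ sum {n ∸ 1} (λ _ → b)
  sum-constExcept {suc n} t i {b} t≈b = begin
    sum t                       ≈⟨ sum-remove t ⟩
    t i ∙ sum (t ∘ punchIn i)   ≈⟨ ∙-congˡ (sum-cong-≋ {n} (λ j → t≈b _ (FinP.punchInᵢ≢i i j))) ⟩
    t i ∙ sum {n} (λ _ → b)     ∎

module FiniteFieldProperties {q : ℕ} (F : FiniteField q) where
  open FiniteField F public
  open IsCommutativeRing isCommutativeRing public hiding (refl; sym; trans)

  commutativeRing : CommutativeRing _ _
  commutativeRing = record { isCommutativeRing = isCommutativeRing }

  open import Algebra.Solver.Ring.NaturalCoefficients.Default
    (CommutativeRing.commutativeSemiring commutativeRing) public
  open import Algebra.Properties.AbelianGroup (CommutativeRing.+-abelianGroup commutativeRing) public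
    using () renaming (∙-cancelˡ to +-cancelˡ; ∙-cancelʳ to +-cancelʳ)

  to : Carrier → Fin q
  to = Inverse.to enum

  from : Fin q → Carrier
  from = Inverse.from enum

  from-to : ∀ x → from (to x) ≡ x
  from-to x = Inverse.inverseʳ enum refl

  to-injective : ∀ {x y} → to x ≡ to y → x ≡ y
  to-injective {x} {y} e = trans (sym (from-to x)) (trans (cong from e) (from-to y))

  from-injective : ∀ {i j} → from i ≡ from j → i ≡ j
  from-injective {i} {j} e = trans (sym (Inverse.inverseˡ enum refl)) (trans (cong to e) (Inverse.inverseˡ enum refl))

  infix 4 _≟_
  _≟_ : (x y : Carrier) → Dec (x ≡ y)
  x ≟ y = map′ to-injective (cong to) (to x Fin.≟ to y)
    where open import Relation.Nullary.Decidable using (map′)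

  T-==⇒≡ : ∀ {x y} → T (x == y) → x ≡ y
  T-==⇒≡ {x} {y} h with to x Fin.≟ to y
  ... | yes tx≡ty = to-injective tx≡ty

  ≡⇒T-== : ∀ {x y} → x ≡ y → T (x == y)
  ≡⇒T-== {x} {y} x≡y = Equivalence.from BoolP.T-≡ (dec-true (to x Fin.≟ to y) (cong to x≡y))

  ≢⇒==≡false : ∀ {x y} → x ≢ y → (x == y) ≡ false
  ≢⇒==≡false {x} {y} x≢y = dec-false (to x Fin.≟ to y) (x≢y ∘ to-injective)

  q≡suc[q∸1] : q ≡ suc (q ∸ 1)
  q≡suc[q∸1] with to 0#
  ... | Fin.zero = refl
  ... | Fin.suc _ = refl

  1≢0 : 1# ≢ 0#
  1≢0 e = 0≢1 (sym e)

  *-cancelʳ-nonzero : ∀ {a b} c → c ≢ 0# → a * c ≡ b * c → a ≡ b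
  *-cancelʳ-nonzero {a} {b} c c≢0 ac≡bc with inverse c c≢0
  ... | c⁻¹ , cc⁻¹≡1 = begin
      a                ≡⟨ solve 2 (λ a c → a := a :* con 1) refl a c ⟩
      a * 1#           ≡⟨ cong (a *_) (sym cc⁻¹≡1) ⟩
      a * (c * c⁻¹)    ≡⟨ sym (*-assoc a c c⁻¹) ⟩
      (a * c) * c⁻¹    ≡⟨ cong (_* c⁻¹) ac≡bc ⟩
      (b * c) * c⁻¹    ≡⟨ *-assoc b c c⁻¹ ⟩
      b * (c * c⁻¹)    ≡⟨ cong (b *_) cc⁻¹≡1 ⟩
      b * 1#           ≡⟨ *-identityʳ b ⟩
      b                ∎
    where open ≡-Reasoning

  *-cancelˡ-nonzero : ∀ {a b} c → c ≢ 0# → c * a ≡ c * b → a ≡ b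
  *-cancelˡ-nonzero {a} {b} c c≢0 e = *-cancelʳ-nonzero c c≢0 (trans (*-comm a c) (trans e (*-comm c b)))

  *-nonzero : ∀ {a b} → a ≢ 0# → b ≢ 0# → a * b ≢ 0#
  *-nonzero {a} {b} a≢0 b≢0 ab≡0 = b≢0 (*-cancelˡ-nonzero a a≢0 (trans ab≡0 (sym (zeroʳ a))))

  ^-homo-* : ∀ x m n → x ^ (m ℕ.+ n) ≡ x ^ m * x ^ n
  ^-homo-* x zero n = sym (*-identityˡ _)
  ^-homo-* x (suc m) n = trans (cong (x *_) (^-homo-* x m n)) (sym (*-assoc x _ _))

  ^-assocʳ : ∀ x m n → (x ^ m) ^ n ≡ x ^ (m ℕ.* n)
  ^-assocʳ x m zero = cong (x ^_) (sym (ℕP.*-zeroʳ m))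
  ^-assocʳ x m (suc n) = begin
    x ^ m * (x ^ m) ^ n        ≡⟨ cong (x ^ m *_) (^-assocʳ x m n) ⟩
    x ^ m * x ^ (m ℕ.* n)      ≡⟨ sym (^-homo-* x m (m ℕ.* n)) ⟩
    x ^ (m ℕ.+ m ℕ.* n)        ≡⟨ cong (x ^_) (sym (ℕP.*-suc m n)) ⟩
    x ^ (m ℕ.* suc n)          ∎
    where open ≡-Reasoning

  ^-distrib-* : ∀ x y n → (x * y) ^ n ≡ x ^ n * y ^ n
  ^-distrib-* x y zero = sym (*-identityˡ 1#)
  ^-distrib-* x y (suc n) rewrite ^-distrib-* x y n =
    solve 4 (λ x y X Y → (x :* y) :* (X :* Y) := (x :* X) :* (y :* Y)) refl x y (x ^ n) (y ^ n)

  1^n≡1 : ∀ n → 1# ^ n ≡ 1#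
  1^n≡1 zero = refl
  1^n≡1 (suc n) = trans (*-identityˡ _) (1^n≡1 n)

  0^n≡0 : ∀ {n} → 0 ℕ.< n → 0# ^ n ≡ 0#
  0^n≡0 {suc n} _ = zeroˡ _

  ^-nonzero : ∀ {x} n → x ≢ 0# → x ^ n ≢ 0#
  ^-nonzero zero x≢0 = 1≢0
  ^-nonzero (suc n) x≢0 = *-nonzero x≢0 (^-nonzero n x≢0)

  open MonoidSum (CommutativeRing.*-commutativeMonoid commutativeRing) public
    using () renaming (sum to ∏; ∑-distrib-+ to ∏-distrib-*; sum-cong-≗ to ∏-cong)

  ∏-const : ∀ n x → ∏ {n} (λ _ → x) ≡ x ^ n
  ∏-const zero x = refl
  ∏-const (suc n) x = cong (x *_) (∏-const n x)

  ∏-nonzero : ∀ {n} (t : Fin n → Carrier) → (∀ i → t i ≢ 0#) → ∏ t ≢ 0#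
  ∏-nonzero {zero} t _ = 1≢0
  ∏-nonzero {suc n} t t≢0 = *-nonzero (t≢0 Fin.zero) (∏-nonzero (t ∘ Fin.suc) (t≢0 ∘ Fin.suc))

  multiplyBy : ∀ x → x ≢ 0# → Permutation q q
  multiplyBy x x≢0 with inverse x x≢0
  ... | x⁻¹ , xx⁻¹≡1 = permutation (λ i → to (x * from i)) (λ i → to (x⁻¹ * from i)) (cancel x x⁻¹ xx⁻¹≡1)
                         (cancel x⁻¹ x (trans (*-comm x⁻¹ x) xx⁻¹≡1))
    where
      cancel : ∀ a b → a * b ≡ 1# → ∀ i → to (a * from (to (b * from i))) ≡ i
      cancel a b ab≡1 i = begin
        to (a * from (to (b * from i)))  ≡⟨ cong (λ y → to (a * y)) (from-to _) ⟩
        to (a * (b * from i))            ≡⟨ cong to (sym (*-assoc a b _)) ⟩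
        to ((a * b) * from i)            ≡⟨ cong (λ y → to (y * from i)) ab≡1 ⟩
        to (1# * from i)                 ≡⟨ cong to (*-identityˡ _) ⟩
        to (from i)                      ≡⟨ Inverse.inverseˡ enum refl ⟩
        i                                ∎
        where open ≡-Reasoning

  multiplyBy-apply : ∀ x (x≢0 : x ≢ 0#) i → from (multiplyBy x x≢0 ⟨$⟩ʳ i) ≡ x * from i
  multiplyBy-apply x x≢0 i with inverse x x≢0
  ... | _ = from-to _

  sum-scaleInvariant : ∀ {c ℓ} (M : CommutativeMonoid c ℓ) (h : Carrier → CommutativeMonoid.Carrier M) →
                       ∀ x → x ≢ 0# → CommutativeMonoid._≈_ M (MonoidSum.sum M (h ∘ from))
                                                               (MonoidSum.sum M (λ i → h (x * from i)))
  sum-scaleInvariant M h x x≢0 = CommutativeMonoid.trans M (sum-permute (h ∘ from) (multiplyBy x x≢0))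
    (CommutativeMonoid.reflexive M (sum-cong-≗ (λ i → cong h (multiplyBy-apply x x≢0 i))))
    where open MonoidSum M using (sum-permute; sum-cong-≗)

  ∏-scaleInvariant : ∀ (h : Carrier → Carrier) x → x ≢ 0# → ∏ (h ∘ from) ≡ ∏ (λ i → h (x * from i))
  ∏-scaleInvariant = sum-scaleInvariant (CommutativeRing.*-commutativeMonoid commutativeRing)

  -- Fermat's little theorem: multiplying by x permutes the field; compare the products of
  -- the nonzero parts y ↦ y (y ≠ 0), 0 ↦ 1 before and after.
  nonzeroPart : Carrier → Carrier
  nonzeroPart y with y ≟ 0#
  ... | yes _ = 1#
  ... | no _ = y

  nonzeroPart-nonzero : ∀ y → nonzeroPart y ≢ 0#
  nonzeroPart-nonzero y with y ≟ 0#
  ... | yes _ = 1≢0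
  ... | no y≢0 = y≢0

  scaleAwayFrom0 : Carrier → Carrier → Carrier
  scaleAwayFrom0 x y with y ≟ 0#
  ... | yes _ = 1#
  ... | no _ = x

  nonzeroPart-* : ∀ {x} → x ≢ 0# → ∀ y → nonzeroPart (x * y) ≡ scaleAwayFrom0 x y * nonzeroPart y
  nonzeroPart-* {x} x≢0 y with y ≟ 0# | x * y ≟ 0#
  ... | yes _   | yes _   = sym (*-identityˡ 1#)
  ... | yes y≡0 | no xy≢0 = ⊥-elim (xy≢0 (trans (cong (x *_) y≡0) (zeroʳ x)))
  ... | no y≢0  | yes xy≡0 = ⊥-elim (*-nonzero x≢0 y≢0 xy≡0)
  ... | no _    | no _    = refl

  ∏-scaleAwayFrom0 : ∀ x → ∏ (λ i → scaleAwayFrom0 x (from i)) ≡ x ^ (q ∸ 1)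
  ∏-scaleAwayFrom0 x = begin
    ∏ (λ i → scaleAwayFrom0 x (from i))          ≡⟨ sum-constExcept (CommutativeRing.*-commutativeMonoid commutativeRing)
                                                       _ (to 0#) away ⟩
    scaleAwayFrom0 x (from (to 0#)) * ∏ {q ∸ 1} (λ _ → x) ≡⟨ cong₂ _*_ at0 (∏-const (q ∸ 1) x) ⟩
    1# * x ^ (q ∸ 1)                              ≡⟨ *-identityˡ _ ⟩
    x ^ (q ∸ 1)                                   ∎
    where
      open ≡-Reasoning
      at0 : scaleAwayFrom0 x (from (to 0#)) ≡ 1#
      at0 with from (to 0#) ≟ 0#
      ... | yes _ = refl
      ... | no ≢0 = ⊥-elim (≢0 (from-to 0#))
      away : ∀ j → j ≢ to 0# → scaleAwayFrom0 x (from j) ≡ x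
      away j j≢0 with from j ≟ 0#
      ... | yes j≡0 = ⊥-elim (j≢0 (trans (sym (Inverse.inverseˡ enum refl)) (cong to j≡0)))
      ... | no _ = refl

  fermat : ∀ x → x ≢ 0# → x ^ (q ∸ 1) ≡ 1#
  fermat x x≢0 = *-cancelʳ-nonzero P (∏-nonzero _ (nonzeroPart-nonzero ∘ from)) (sym P≡x^[q-1]P)
    where
      open ≡-Reasoning
      P : Carrier
      P = ∏ (nonzeroPart ∘ from)
      P≡x^[q-1]P : 1# * P ≡ x ^ (q ∸ 1) * P
      P≡x^[q-1]P = begin
        1# * P                                                   ≡⟨ *-identityˡ P ⟩
        P                                                        ≡⟨ ∏-scaleInvariant nonzeroPart x x≢0 ⟩
        ∏ (λ i → nonzeroPart (x * from i))                       ≡⟨ ∏-cong {q} (λ i → nonzeroPart-* x≢0 (from i)) ⟩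
        ∏ (λ i → scaleAwayFrom0 x (from i) * nonzeroPart (from i)) ≡⟨ ∏-distrib-* {q} _ _ ⟩
        ∏ (λ i → scaleAwayFrom0 x (from i)) * P                  ≡⟨ cong (_* P) (∏-scaleAwayFrom0 x) ⟩
        x ^ (q ∸ 1) * P                                          ∎

  count-elements : ∀ {P : Carrier → Set} (P? : ∀ x → Dec (P x)) →
                   length (filter P? elements) ≡ ∑ (λ i → indicator (P? (from i)))
  count-elements P? = trans (cong (length ∘ filter P?) (map-tabulate id from)) (length-filter-tabulate P? from)

module PolynomialFunctions {q : ℕ} (F : FiniteField q) where
  open FiniteFieldProperties F

  PolyBelow : ℕ → (Carrier → Carrier) → Set
  PolyBelow zero f = ∀ x → f x ≡ 0#
  PolyBelow (suc n) f = Σ Carrier λ c → Σ (Carrier → Carrier) λ g → PolyBelow n g × (∀ x → f x ≡ c + x * g x)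

  polyBelow-+ : ∀ n {f g} → PolyBelow n f → PolyBelow n g → PolyBelow n (λ x → f x + g x)
  polyBelow-+ zero f≡0 g≡0 x = trans (cong₂ _+_ (f≡0 x) (g≡0 x)) (+-identityʳ 0#)
  polyBelow-+ (suc n) (c , f' , f'↓ , f≡) (d , g' , g'↓ , g≡) =
    c + d , (λ x → f' x + g' x) , polyBelow-+ n f'↓ g'↓ , λ x → trans (cong₂ _+_ (f≡ x) (g≡ x))
      (solve 5 (λ c d x F G → (c :+ x :* F) :+ (d :+ x :* G) := (c :+ d) :+ x :* (F :+ G)) refl c d x (f' x) (g' x))

  polyBelow-scale : ∀ n r {f} → PolyBelow n f → PolyBelow n (λ x → r * f x)
  polyBelow-scale zero r f≡0 x = trans (cong (r *_) (f≡0 x)) (zeroʳ r)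
  polyBelow-scale (suc n) r (c , f' , f'↓ , f≡) =
    r * c , (λ x → r * f' x) , polyBelow-scale n r f'↓ , λ x → trans (cong (r *_) (f≡ x))
      (solve 4 (λ r c x F → r :* (c :+ x :* F) := r :* c :+ x :* (r :* F)) refl r c x (f' x))

  polyBelow-suc : ∀ n {f} → PolyBelow n f → PolyBelow (suc n) f
  polyBelow-suc zero {f} f≡0 = 0# , f , f≡0 , λ x → begin
      f x             ≡⟨ f≡0 x ⟩
      0#              ≡⟨ solve 1 (λ x → con 0 := con 0 :+ x :* con 0) refl x ⟩
      0# + x * 0#     ≡⟨ cong (λ y → 0# + x * y) (sym (f≡0 x)) ⟩
      0# + x * f x    ∎
    where open ≡-Reasoning
  polyBelow-suc (suc n) (c , f' , f'↓ , f≡) = c , f' , polyBelow-suc n f'↓ , f≡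

  -- The factor theorem f x − f r = (x − r) h x, stated without subtraction.
  polyBelow-factor : ∀ n {f} → PolyBelow (suc n) f → ∀ r →
                     Σ (Carrier → Carrier) λ h → PolyBelow n h × (∀ x → f x + r * h x ≡ f r + x * h x)
  polyBelow-factor zero {f} (c , f' , f'≡0 , f≡) r = (λ _ → 0#) , (λ _ → refl) , λ x → begin
      f x + r * 0#         ≡⟨ cong (λ y → y + r * 0#) (trans (f≡ x) (cong (λ y → c + x * y) (f'≡0 x))) ⟩
      c + x * 0# + r * 0#  ≡⟨ solve 3 (λ c x r → c :+ x :* con 0 :+ r :* con 0 := c :+ r :* con 0 :+ x :* con 0) refl c x r ⟩
      c + r * 0# + x * 0#  ≡⟨ cong (λ y → y + x * 0#) (sym (trans (f≡ r) (cong (λ y → c + r * y) (f'≡0 r)))) ⟩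
      f r + x * 0#         ∎
    where open ≡-Reasoning
  polyBelow-factor (suc n) {f} (c , f' , f'↓ , f≡) r with polyBelow-factor n f'↓ r
  ... | h' , h'↓ , f'-factor = (λ x → f' x + r * h' x) , polyBelow-+ (suc n) f'↓ (polyBelow-suc n (polyBelow-scale n r h'↓)) ,
    λ x → begin
      f x + r * (f' x + r * h' x)           ≡⟨ cong₂ (λ a b → a + r * b) (f≡ x) (f'-factor x) ⟩
      (c + x * f' x) + r * (f' r + x * h' x)
        ≡⟨ solve 6 (λ c x r G Gr H → (c :+ x :* G) :+ r :* (Gr :+ x :* H) := (c :+ r :* Gr) :+ x :* (G :+ r :* H))
                   refl c x r (f' x) (f' r) (h' x) ⟩
      (c + r * f' r) + x * (f' x + r * h' x)  ≡⟨ cong (_+ x * (f' x + r * h' x)) (sym (f≡ r)) ⟩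
      f r + x * (f' x + r * h' x)            ∎
    where open ≡-Reasoning

  polyBelow-roots : ∀ k {n} {f} → PolyBelow k f → (g : Fin n → Carrier) → Injective _≡_ _≡_ g →
                    (∀ i → f (g i) ≡ 0#) → k ≤ n → ∀ x → f x ≡ 0#
  polyBelow-roots zero f↓ _ _ _ _ = f↓
  polyBelow-roots (suc k) {suc n} {f} f↓ g g-injective g-roots (ℕ.s≤s k≤n) x
    with polyBelow-factor k f↓ (g Fin.zero)
  ... | h , h↓ , f-factor = begin
      f x                 ≡⟨ sym (trans (cong (f x +_) (trans (cong (r *_) (h≡0 x)) (zeroʳ r))) (+-identityʳ (f x))) ⟩
      f x + r * h x       ≡⟨ f-factor x ⟩
      f r + x * h x       ≡⟨ cong₂ (λ a b → a + x * b) (g-roots Fin.zero) (h≡0 x) ⟩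
      0# + x * 0#         ≡⟨ solve 1 (λ x → con 0 :+ x :* con 0 := con 0) refl x ⟩
      0#                  ∎
    where
      open ≡-Reasoning
      r : Carrier
      r = g Fin.zero
      h-roots : ∀ i → h (g (Fin.suc i)) ≡ 0#
      h-roots i with h (g (Fin.suc i)) ≟ 0#
      ... | yes h≡0 = h≡0
      ... | no h≢0 = ⊥-elim (FinP.0≢1+n (g-injective (*-cancelʳ-nonzero _ h≢0 rh≡yh)))
        where
          y : Carrier
          y = g (Fin.suc i)
          rh≡yh : r * h y ≡ y * h y
          rh≡yh = begin
            r * h y          ≡⟨ sym (+-identityˡ _) ⟩
            0# + r * h y     ≡⟨ cong (_+ r * h y) (sym (g-roots (Fin.suc i))) ⟩
            f y + r * h y    ≡⟨ f-factor y ⟩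
            f r + y * h y    ≡⟨ cong (_+ y * h y) (g-roots Fin.zero) ⟩
            0# + y * h y     ≡⟨ +-identityˡ _ ⟩
            y * h y          ∎
      h≡0 : ∀ x → h x ≡ 0#
      h≡0 = polyBelow-roots k h↓ (g ∘ Fin.suc) (FinP.suc-injective ∘ g-injective) h-roots k≤n

  polyBelow-^+const : ∀ k e → PolyBelow (suc k) (λ x → x ^ k + e)
  polyBelow-^+const zero e = 1# + e , (λ _ → 0#) , (λ _ → refl) , λ x → solve 2 (λ e x → con 1 :+ e := (con 1 :+ e) :+ x :* con 0) refl e x
  polyBelow-^+const (suc k) e = e , (λ x → x ^ k + 0#) , polyBelow-^+const k 0# , λ x →
    solve 3 (λ e x X → x :* X :+ e := e :+ x :* (X :+ con 0)) refl e x (x ^ k)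

  cast-cast : ∀ k → Fin.cast q≡suc[q∸1] (Fin.cast (sym q≡suc[q∸1]) k) ≡ k
  cast-cast = FinP.cast-involutive q≡suc[q∸1] (sym q≡suc[q∸1])

  nonzeroElement : Fin (q ∸ 1) → Carrier
  nonzeroElement j = from (Fin.cast (sym q≡suc[q∸1]) (punchIn (Fin.cast q≡suc[q∸1] (to 0#)) j))

  nonzeroElement-injective : Injective _≡_ _≡_ nonzeroElement
  nonzeroElement-injective {i} {j} e =
    FinP.punchIn-injective _ i j (trans (sym (cast-cast _)) (trans (cong (Fin.cast q≡suc[q∸1]) (from-injective e)) (cast-cast _)))

  nonzeroElement-nonzero : ∀ j → nonzeroElement j ≢ 0#
  nonzeroElement-nonzero j e = FinP.punchInᵢ≢i _ j (begin
      punchIn p j                                                      ≡⟨ sym (cast-cast _) ⟩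
      Fin.cast q≡suc[q∸1] (Fin.cast (sym q≡suc[q∸1]) (punchIn p j))   ≡⟨ cong (Fin.cast q≡suc[q∸1]) (trans (sym (Inverse.inverseˡ enum refl)) (cong to e)) ⟩
      p                                                                ∎)
    where
      open ≡-Reasoning
      p : Fin (suc (q ∸ 1))
      p = Fin.cast q≡suc[q∸1] (to 0#)

  -- Were every nonzero x an s-th root of unity, x^s − 1 would have q − 1 > s roots
  -- and so vanish at 0 too.
  not-all-powers-one : ∀ s → 1 ≤ s → s ℕ.< q ∸ 1 → ¬ (∀ x → x ≢ 0# → x ^ s ≡ 1#)
  not-all-powers-one (suc s) _ s<q-1 all-one = 1≢0 (begin
      1#                     ≡⟨ solve 1 (λ o → o := o :+ con 0) refl 1# ⟩
      1# + 0#                ≡⟨ cong (1# +_) (sym vanishes-at-0) ⟩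
      1# + (0# ^ suc s + - 1#) ≡⟨ cong (λ y → 1# + (y + - 1#)) (zeroˡ _) ⟩
      1# + (0# + - 1#)       ≡⟨ cong (1# +_) (+-identityˡ _) ⟩
      1# + - 1#              ≡⟨ -‿inverseʳ 1# ⟩
      0#                     ∎)
    where
      open ≡-Reasoning
      vanishes-at-0 : 0# ^ suc s + - 1# ≡ 0#
      vanishes-at-0 = polyBelow-roots (suc (suc s)) (polyBelow-^+const (suc s) (- 1#)) nonzeroElement nonzeroElement-injective
        (λ i → trans (cong (_+ - 1#) (all-one _ (nonzeroElement-nonzero i))) (-‿inverseʳ 1#)) s<q-1 0#

  ∃-non-power-one : ∀ s → 1 ≤ s → s ℕ.< q ∸ 1 → ∃ λ x → x ≢ 0# × x ^ s ≢ 1#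
  ∃-non-power-one s 1≤s s<q-1
    with FinP.¬∀⟶∃¬ q (λ i → from i ≢ 0# → from i ^ s ≡ 1#) power-one?
           (λ all-one → not-all-powers-one s 1≤s s<q-1 λ x x≢0 →
              subst (λ y → y ^ s ≡ 1#) (from-to x) (all-one (to x) (λ e → x≢0 (trans (sym (from-to x)) e))))
    where
      power-one? : ∀ i → Dec (from i ≢ 0# → from i ^ s ≡ 1#)
      power-one? i with from i ≟ 0# | from i ^ s ≟ 1#
      ... | _ | yes e = yes (λ _ → e)
      ... | yes i≡0 | no _ = yes (λ i≢0 → ⊥-elim (i≢0 i≡0))
      ... | no i≢0 | no ≢1 = no (λ h → ≢1 (h i≢0))
  ... | i , ¬power-one = from i , (λ i≡0 → ¬power-one (λ i≢0 → ⊥-elim (i≢0 i≡0))) , (λ e → ¬power-one (λ _ → e))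

module MinimalPeriods {q : ℕ} (F : FiniteField q) where
  open FiniteFieldProperties F

  IsMinimalPeriod : (Carrier → Carrier) → Carrier → ℕ → Set
  IsMinimalPeriod σ x m = 0 ℕ.< m × iter σ m x ≡ x × (∀ j → 0 ℕ.< j → iter σ j x ≡ x → m ≤ j)

  minimalPeriod-unique : ∀ {σ x m n} → IsMinimalPeriod σ x m → IsMinimalPeriod σ x n → m ≡ n
  minimalPeriod-unique (m>0 , σᵐx≡x , m-min) (n>0 , σⁿx≡x , n-min) = ℕP.≤-antisym (m-min _ n>0 σⁿx≡x) (n-min _ m>0 σᵐx≡x)

  hasPeriod-sound : ∀ {σ x L} → 0 ℕ.< L → T (hasPeriod σ L x) → IsMinimalPeriod σ x L
  hasPeriod-sound {σ} {x} {L} L>0 h = L>0 , T-==⇒≡ returns , minimal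
    where
      returns : T (iter σ L x == x)
      returns = proj₁ (Equivalence.to BoolP.T-∧ h)
      no-earlier-return : ∀ {i} → i ℕ.< L ∸ 1 → T (not (iter σ (suc i) x == x))
      no-earlier-return = applyUpTo⁻ _ (L ∸ 1) (all⁺ _ _ (proj₂ (Equivalence.to BoolP.T-∧ h)))
      minimal : ∀ j → 0 ℕ.< j → iter σ j x ≡ x → L ≤ j
      minimal (suc j) _ σʲx≡x with L ℕ.≤? suc j
      ... | yes L≤j = L≤j
      ... | no L≰j = ⊥-elim (subst (T ∘ not) (Equivalence.to BoolP.T-≡ (≡⇒T-== σʲx≡x))
                               (no-earlier-return (ℕP.∸-monoˡ-< (ℕP.≰⇒> L≰j) (ℕ.s≤s ℕ.z≤n))))

  hasPeriod-complete : ∀ {σ x m} → IsMinimalPeriod σ x m → T (hasPeriod σ m x)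
  hasPeriod-complete {σ} {x} {suc m} (_ , σᵐx≡x , m-min) =
    Equivalence.from BoolP.T-∧ (≡⇒T-== σᵐx≡x , all⁻ _ (applyUpTo⁺₁ id m no-earlier-return))
    where
      no-earlier-return : ∀ {i} → i ℕ.< m → T (not (iter σ (suc i) x == x))
      no-earlier-return {i} i<m = Equivalence.from BoolP.T-not-≡ (≢⇒==≡false λ σⁱ⁺¹x≡x →
        ℕP.<⇒≱ (ℕ.s≤s i<m) (m-min (suc i) (ℕ.s≤s ℕ.z≤n) σⁱ⁺¹x≡x))

  indicator-hasPeriod : ∀ {σ x m} → IsMinimalPeriod σ x m → ∀ L → .⦃ _ : NonZero L ⦄ →
                        indicator (hasPeriod σ L x BoolP.≟ true) ≡ δ m L
  indicator-hasPeriod {σ} {x} {m} period-m L = trans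
    (indicator-cong (hasPeriod σ L x BoolP.≟ true) (m ℕ.≟ L)
      (λ h → minimalPeriod-unique period-m (hasPeriod-sound (ℕ.>-nonZero⁻¹ L) (Equivalence.from BoolP.T-≡ h)))
      (λ { refl → Equivalence.to BoolP.T-≡ (hasPeriod-complete period-m) }))
    (sym (δ≡indicator m L))

  iter-on-invariant : ∀ {σ : Carrier → Carrier} {y} (P : Carrier → Set) → (∀ z → P z → σ z ≡ y * z) →
                      (∀ z → P z → P (y * z)) → ∀ {x} → P x → ∀ k → iter σ k x ≡ y ^ k * x
  iter-on-invariant {σ} {y} P σ≡y* P-stable {x} Px k = proj₁ (orbit k)
    where
      orbit : ∀ k → iter σ k x ≡ y ^ k * x × P (iter σ k x)
      orbit zero = sym (*-identityˡ x) , Px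
      orbit (suc k) with orbit k
      ... | σᵏx≡yᵏx , Pσᵏx = trans (σ≡y* _ Pσᵏx) (trans (cong (y *_) σᵏx≡yᵏx) (sym (*-assoc y (y ^ k) x))) ,
                             subst P (sym (σ≡y* _ Pσᵏx)) (P-stable _ Pσᵏx)

  minimalPeriod-scaling : ∀ {σ x y m} → x ≢ 0# → HasOrder y m → (∀ k → iter σ k x ≡ y ^ k * x) → IsMinimalPeriod σ x m
  minimalPeriod-scaling {σ} {x} {y} {m} x≢0 (m>0 , yᵐ≡1 , m-min) orbit =
    m>0 , trans (orbit m) (trans (cong (_* x) yᵐ≡1) (*-identityˡ x)) ,
    λ j j>0 σʲx≡x → m-min j j>0 (*-cancelʳ-nonzero x x≢0 (trans (sym (orbit j)) (trans σʲx≡x (sym (*-identityˡ x)))))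

  minimalPeriod-fixed : ∀ {σ x} → σ x ≡ x → IsMinimalPeriod σ x 1
  minimalPeriod-fixed σx≡x = ℕ.s≤s ℕ.z≤n , σx≡x , λ _ j>0 _ → j>0

module CubeRootsOfUnity {q : ℕ} (F : FiniteField q) (ζ : FiniteField.Carrier F)
                        (ζ-order3 : FiniteField.HasOrder F ζ 3) where
  open FiniteFieldProperties F

  ζ² : Carrier
  ζ² = ζ ^ 2

  ζ³≡1 : ζ ^ 3 ≡ 1#
  ζ³≡1 = proj₁ (proj₂ ζ-order3)

  ζ≢1 : ζ ≢ 1#
  ζ≢1 ζ≡1 with proj₂ (proj₂ ζ-order3) 1 (ℕ.s≤s ℕ.z≤n) (trans (*-identityʳ ζ) ζ≡1)
  ... | ℕ.s≤s ()

  ζ²≢1 : ζ² ≢ 1#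
  ζ²≢1 ζ²≡1 with proj₂ (proj₂ ζ-order3) 2 (ℕ.s≤s ℕ.z≤n) ζ²≡1
  ... | ℕ.s≤s (ℕ.s≤s ())

  ζ≢0 : ζ ≢ 0#
  ζ≢0 ζ≡0 = 1≢0 (trans (sym ζ³≡1) (trans (cong (_^ 3) ζ≡0) (zeroˡ _)))

  ζ²≢0 : ζ² ≢ 0#
  ζ²≢0 = ^-nonzero 2 ζ≢0

  ζ*ζ≡ζ² : ζ * ζ ≡ ζ²
  ζ*ζ≡ζ² = cong (ζ *_) (sym (*-identityʳ ζ))

  ζ≢ζ² : ζ ≢ ζ²
  ζ≢ζ² ζ≡ζ² = ζ≢1 (sym (*-cancelˡ-nonzero ζ ζ≢0 (trans (*-identityʳ ζ) (trans ζ≡ζ² (sym ζ*ζ≡ζ²)))))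

  ζ²*ζ≡1 : ζ² * ζ ≡ 1#
  ζ²*ζ≡1 = trans (*-comm ζ² ζ) ζ³≡1

  ζ²*ζ²≡ζ : ζ² * ζ² ≡ ζ
  ζ²*ζ²≡ζ = trans (solve 1 (λ z → (z :* (z :* con 1)) :* (z :* (z :* con 1)) := z :* (z :* (z :* (z :* con 1)))) refl ζ)
                  (trans (cong (ζ *_) ζ³≡1) (*-identityʳ ζ))

  Φ₃ : Carrier → Carrier
  Φ₃ y = 1# + y + y * y

  Φ₃-1 : Φ₃ 1# ≡ three
  Φ₃-1 = cong (1# + 1# +_) (*-identityʳ 1#)

  Φ₃-primitive : ∀ {y} → y ^ 3 ≡ 1# → y ≢ 1# → Φ₃ y ≡ 0#
  Φ₃-primitive {y} y³≡1 y≢1 with Φ₃ y ≟ 0#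
  ... | yes Φ₃y≡0 = Φ₃y≡0
  ... | no Φ₃y≢0 = ⊥-elim (y≢1 (*-cancelʳ-nonzero (Φ₃ y) Φ₃y≢0 (begin
      y * Φ₃ y            ≡⟨ solve 1 (λ y → y :* (con 1 :+ y :+ y :* y) := (y :+ y :* y) :+ y :* (y :* (y :* con 1))) refl y ⟩
      (y + y * y) + y ^ 3 ≡⟨ cong ((y + y * y) +_) y³≡1 ⟩
      (y + y * y) + 1#    ≡⟨ solve 1 (λ y → (y :+ y :* y) :+ con 1 := con 1 :* (con 1 :+ y :+ y :* y)) refl y ⟩
      1# * Φ₃ y           ∎)))
    where open ≡-Reasoning

  Φ₃-ζ : Φ₃ ζ ≡ 0#
  Φ₃-ζ = Φ₃-primitive ζ³≡1 ζ≢1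

  Φ₃-ζ² : Φ₃ ζ² ≡ 0#
  Φ₃-ζ² = Φ₃-primitive (trans (^-assocʳ ζ 2 3) (trans (sym (^-assocʳ ζ 3 2)) (trans (cong (_^ 2) ζ³≡1) (1^n≡1 2)))) ζ²≢1

  -- A primitive cube root y ≠ ζ satisfies y + y² = ζ + ζ², i.e. (y − ζ)(1 + y + ζ) = 0,
  -- so y = −1 − ζ = ζ².
  cube-roots-of-unity : ∀ {y} → y ^ 3 ≡ 1# → y ≡ 1# ⊎ y ≡ ζ ⊎ y ≡ ζ²
  cube-roots-of-unity {y} y³≡1 with y ≟ 1#
  ... | yes y≡1 = inj₁ y≡1
  ... | no y≢1 with 1# + y + ζ ≟ 0#
  ...   | no s≢0 = inj₂ (inj₁ (*-cancelʳ-nonzero _ s≢0 (begin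
      y * (1# + y + ζ)     ≡⟨ solve 2 (λ y z → y :* (con 1 :+ y :+ z) := (y :+ y :* y) :+ y :* z) refl y ζ ⟩
      (y + y * y) + y * ζ  ≡⟨ cong (_+ y * ζ) (+-cancelˡ 1# _ _ (trans (sym (+-assoc 1# y (y * y)))
                                (trans (Φ₃-primitive y³≡1 y≢1) (trans (sym Φ₃-ζ) (+-assoc 1# ζ (ζ * ζ)))))) ⟩
      (ζ + ζ * ζ) + y * ζ  ≡⟨ solve 2 (λ y z → (z :+ z :* z) :+ y :* z := z :* (con 1 :+ y :+ z)) refl y ζ ⟩
      ζ * (1# + y + ζ)     ∎)))
    where open ≡-Reasoning
  ...   | yes s≡0 = inj₂ (inj₂ (trans (+-cancelˡ (1# + ζ) y (ζ * ζ) (begin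
      (1# + ζ) + y         ≡⟨ solve 2 (λ y z → (con 1 :+ z) :+ y := con 1 :+ y :+ z) refl y ζ ⟩
      1# + y + ζ           ≡⟨ trans s≡0 (sym Φ₃-ζ) ⟩
      (1# + ζ) + ζ * ζ     ∎)) ζ*ζ≡ζ²))
    where open ≡-Reasoning

module CubicCharacter {q : ℕ} (F : FiniteField q) (ζ : FiniteField.Carrier F)
                      (ζ-order3 : FiniteField.HasOrder F ζ 3) (s : ℕ) (q≡1+s*3 : q ≡ suc (s ℕ.* 3)) where
  open FiniteFieldProperties F
  open PolynomialFunctions F using (∃-non-power-one)
  open CubeRootsOfUnity F ζ ζ-order3

  s>0 : 0 ℕ.< s
  s>0 = ℕP.n≢0⇒n>0 λ s≡0 → 0≢1 (to-injective (Fin-trivial (trans q≡1+s*3 (cong (λ n → suc (n ℕ.* 3)) s≡0)) (to 0#) (to 1#)))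
    where
      Fin-trivial : q ≡ 1 → (i j : Fin q) → i ≡ j
      Fin-trivial q≡1 = subst (λ n → (i j : Fin n) → i ≡ j) (sym q≡1) λ { Fin.zero Fin.zero → refl }

  instance
    s≢0 : NonZero s
    s≢0 = ℕ.>-nonZero s>0

  χ : Carrier → Carrier
  χ x = x ^ s

  χ-0 : χ 0# ≡ 0#
  χ-0 = 0^n≡0 s>0

  χ-* : ∀ x y → χ (x * y) ≡ χ x * χ y
  χ-* x y = ^-distrib-* x y s

  χ-cubed : ∀ {x} → x ≢ 0# → χ x ^ 3 ≡ 1#
  χ-cubed {x} x≢0 = trans (^-assocʳ x s 3) (trans (cong (x ^_) (cong (_∸ 1) (sym q≡1+s*3))) (fermat x x≢0))

  χ-values : ∀ x → x ≡ 0# ⊎ χ x ≡ 1# ⊎ χ x ≡ ζ ⊎ χ x ≡ ζ²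
  χ-values x with x ≟ 0#
  ... | yes x≡0 = inj₁ x≡0
  ... | no x≢0 = inj₂ (cube-roots-of-unity (χ-cubed x≢0))

  χ≡τ⇒nonzero : ∀ {x τ} → τ ≢ 0# → χ x ≡ τ → x ≢ 0#
  χ≡τ⇒nonzero τ≢0 χx≡τ x≡0 = τ≢0 (trans (sym χx≡τ) (trans (cong χ x≡0) χ-0))

  χ-*-kernel : ∀ {u} → χ u ≡ 1# → ∀ x → χ (u * x) ≡ χ x
  χ-*-kernel {u} χu≡1 x = trans (χ-* u x) (trans (cong (_* χ x) χu≡1) (*-identityˡ (χ x)))

  ∃-χ≡ζ : ∃ λ g → χ g ≡ ζ
  ∃-χ≡ζ with ∃-non-power-one s s>0 s<q-1
    where
      s<q-1 : s ℕ.< q ∸ 1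
      s<q-1 = subst (s ℕ.<_) (cong (_∸ 1) (sym q≡1+s*3)) (ℕP.m<m*n s 3 (ℕ.s≤s (ℕ.s≤s ℕ.z≤n)))
  ... | x , x≢0 , χx≢1 with χ-values x
  ...   | inj₁ x≡0 = ⊥-elim (x≢0 x≡0)
  ...   | inj₂ (inj₁ χx≡1) = ⊥-elim (χx≢1 χx≡1)
  ...   | inj₂ (inj₂ (inj₁ χx≡ζ)) = x , χx≡ζ
  ...   | inj₂ (inj₂ (inj₂ χx≡ζ²)) = x * x , trans (χ-* x x) (trans (cong₂ _*_ χx≡ζ² χx≡ζ²) ζ²*ζ²≡ζ)

  χ-inverse : ∀ {u u'} → χ u ≡ 1# → u * u' ≡ 1# → χ u' ≡ 1#
  χ-inverse {u} {u'} χu≡1 uu'≡1 = begin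
    χ u'            ≡⟨ sym (*-identityˡ (χ u')) ⟩
    1# * χ u'       ≡⟨ cong (_* χ u') (sym χu≡1) ⟩
    χ u * χ u'      ≡⟨ sym (χ-* u u') ⟩
    χ (u * u')      ≡⟨ cong χ uu'≡1 ⟩
    1# ^ s          ≡⟨ 1^n≡1 s ⟩
    1#              ∎
    where open ≡-Reasoning

  χ≡1-of-order : ∀ {y k} → HasOrder y k → k ∣ s → χ y ≡ 1#
  χ≡1-of-order {y} {k} (_ , yᵏ≡1 , _) (divides j s≡j*k) = begin
    y ^ s           ≡⟨ cong (y ^_) (trans s≡j*k (ℕP.*-comm j k)) ⟩
    y ^ (k ℕ.* j)   ≡⟨ sym (^-assocʳ y k j) ⟩
    (y ^ k) ^ j     ≡⟨ cong (_^ j) yᵏ≡1 ⟩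
    1# ^ j          ≡⟨ 1^n≡1 j ⟩
    1#              ∎
    where open ≡-Reasoning

  classSize : Carrier → ℕ
  classSize τ = ∑ (λ i → indicator (χ (from i) ≟ τ))

  classSize-* : ∀ {g ρ} → g ≢ 0# → ρ ≢ 0# → χ g ≡ ρ → ∀ τ → classSize τ ≡ classSize (ρ * τ)
  classSize-* {g} {ρ} g≢0 ρ≢0 χg≡ρ τ = trans (∑-cong in-class-*)
    (sym (sum-scaleInvariant ℕP.+-0-commutativeMonoid (λ y → indicator (χ y ≟ ρ * τ)) g g≢0))
    where
      in-class-* : ∀ i → indicator (χ (from i) ≟ τ) ≡ indicator (χ (g * from i) ≟ ρ * τ)
      in-class-* i = indicator-cong (χ (from i) ≟ τ) (χ (g * from i) ≟ ρ * τ)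
        (λ χy≡τ → trans (χ-* g (from i)) (cong₂ _*_ χg≡ρ χy≡τ))
        (λ χgy≡ρτ → *-cancelˡ-nonzero ρ ρ≢0 (trans (cong (_* χ (from i)) (sym χg≡ρ)) (trans (sym (χ-* g (from i))) χgy≡ρτ)))

  zeroCount : ∑ (λ i → indicator (from i ≟ 0#)) ≡ 1
  zeroCount = trans (sum-constExcept ℕP.+-0-commutativeMonoid _ (to 0#) off-0)
                    (cong₂ ℕ._+_ (indicator-yes (from (to 0#) ≟ 0#) (from-to 0#)) (sum-replicate-zero (q ∸ 1)))
    where
      open MonoidSum ℕP.+-0-commutativeMonoid using (sum-replicate-zero)
      off-0 : ∀ j → j ≢ to 0# → indicator (from j ≟ 0#) ≡ 0
      off-0 j j≢0 = indicator-no (from j ≟ 0#) (λ e → j≢0 (trans (sym (Inverse.inverseˡ enum refl)) (cong to e)))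

  classWeight : ℕ → ℕ → ℕ → ℕ → Carrier → ℕ
  classWeight w₀ w₁ w₂ w₃ x = w₀ ℕ.* indicator (x ≟ 0#) ℕ.+ w₁ ℕ.* indicator (χ x ≟ 1#)
                              ℕ.+ w₂ ℕ.* indicator (χ x ≟ ζ) ℕ.+ w₃ ℕ.* indicator (χ x ≟ ζ²)

  private
    χ-outside : ∀ {x τ} → χ x ≡ τ → ∀ {τ'} → τ ≢ τ' → indicator (χ x ≟ τ') ≡ 0
    χ-outside {x} χx≡τ τ≢τ' = indicator-no (χ x ≟ _) (λ χx≡τ' → τ≢τ' (trans (sym χx≡τ) χx≡τ'))

  module _ (w₀ w₁ w₂ w₃ : ℕ) {x : Carrier} where
    classWeight-0 : x ≡ 0# → classWeight w₀ w₁ w₂ w₃ x ≡ w₀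
    classWeight-0 x≡0
      rewrite indicator-yes (x ≟ 0#) x≡0 | χ-outside (trans (cong χ x≡0) χ-0) (1≢0 ∘ sym)
            | χ-outside (trans (cong χ x≡0) χ-0) (ζ≢0 ∘ sym) | χ-outside (trans (cong χ x≡0) χ-0) (ζ²≢0 ∘ sym)
      = ℕSolver.solve (w₀ ∷ w₁ ∷ w₂ ∷ w₃ ∷ [])

    classWeight-1 : χ x ≡ 1# → classWeight w₀ w₁ w₂ w₃ x ≡ w₁
    classWeight-1 χx≡1
      rewrite indicator-no (x ≟ 0#) (χ≡τ⇒nonzero 1≢0 χx≡1) | indicator-yes (χ x ≟ 1#) χx≡1
            | χ-outside χx≡1 (ζ≢1 ∘ sym) | χ-outside χx≡1 (ζ²≢1 ∘ sym)
      = ℕSolver.solve (w₀ ∷ w₁ ∷ w₂ ∷ w₃ ∷ [])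

    classWeight-ζ : χ x ≡ ζ → classWeight w₀ w₁ w₂ w₃ x ≡ w₂
    classWeight-ζ χx≡ζ
      rewrite indicator-no (x ≟ 0#) (χ≡τ⇒nonzero ζ≢0 χx≡ζ) | χ-outside χx≡ζ ζ≢1
            | indicator-yes (χ x ≟ ζ) χx≡ζ | χ-outside χx≡ζ ζ≢ζ²
      = ℕSolver.solve (w₀ ∷ w₁ ∷ w₂ ∷ w₃ ∷ [])

    classWeight-ζ² : χ x ≡ ζ² → classWeight w₀ w₁ w₂ w₃ x ≡ w₃
    classWeight-ζ² χx≡ζ²
      rewrite indicator-no (x ≟ 0#) (χ≡τ⇒nonzero ζ²≢0 χx≡ζ²) | χ-outside χx≡ζ² ζ²≢1
            | χ-outside χx≡ζ² (ζ≢ζ² ∘ sym) | indicator-yes (χ x ≟ ζ²) χx≡ζ²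
      = ℕSolver.solve (w₀ ∷ w₁ ∷ w₂ ∷ w₃ ∷ [])

  ∑-classWeight : ∀ w₀ w₁ w₂ w₃ → ∑ (classWeight w₀ w₁ w₂ w₃ ∘ from)
                  ≡ w₀ ℕ.+ w₁ ℕ.* classSize 1# ℕ.+ w₂ ℕ.* classSize ζ ℕ.+ w₃ ℕ.* classSize ζ²
  ∑-classWeight w₀ w₁ w₂ w₃ = begin
    ∑ (λ i → A i ℕ.+ B i ℕ.+ C i ℕ.+ D i)   ≡⟨ ∑-distrib-+ {q} _ _ ⟩
    ∑ (λ i → A i ℕ.+ B i ℕ.+ C i) ℕ.+ ∑ D   ≡⟨ cong (ℕ._+ ∑ D) (∑-distrib-+ {q} _ _) ⟩
    ∑ (λ i → A i ℕ.+ B i) ℕ.+ ∑ C ℕ.+ ∑ D   ≡⟨ cong (λ n → n ℕ.+ ∑ C ℕ.+ ∑ D) (∑-distrib-+ {q} _ _) ⟩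
    ∑ A ℕ.+ ∑ B ℕ.+ ∑ C ℕ.+ ∑ D              ≡⟨ cong₂ ℕ._+_ (cong₂ ℕ._+_ (cong₂ ℕ._+_
                                                  (trans (∑-*ˡ {q} w₀ _) (trans (cong (w₀ ℕ.*_) zeroCount) (ℕP.*-identityʳ w₀)))
                                                  (∑-*ˡ {q} w₁ _)) (∑-*ˡ {q} w₂ _)) (∑-*ˡ {q} w₃ _) ⟩
    w₀ ℕ.+ w₁ ℕ.* classSize 1# ℕ.+ w₂ ℕ.* classSize ζ ℕ.+ w₃ ℕ.* classSize ζ² ∎
    where
      open ≡-Reasoning
      A B C D : Fin q → ℕ
      A i = w₀ ℕ.* indicator (from i ≟ 0#)
      B i = w₁ ℕ.* indicator (χ (from i) ≟ 1#)
      C i = w₂ ℕ.* indicator (χ (from i) ≟ ζ)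
      D i = w₃ ℕ.* indicator (χ (from i) ≟ ζ²)

  classWeight-partition : ∀ x → classWeight 1 1 1 1 x ≡ 1
  classWeight-partition x with χ-values x
  ... | inj₁ x≡0 = classWeight-0 1 1 1 1 x≡0
  ... | inj₂ (inj₁ χx≡1) = classWeight-1 1 1 1 1 χx≡1
  ... | inj₂ (inj₂ (inj₁ χx≡ζ)) = classWeight-ζ 1 1 1 1 χx≡ζ
  ... | inj₂ (inj₂ (inj₂ χx≡ζ²)) = classWeight-ζ² 1 1 1 1 χx≡ζ²

  -- Multiplication by g with χ g = ζ carries each class onto the next one, so the three
  -- classes of nonzero elements have the same size, which the count 1 + 3·size = q pins down.
  classSize-rotate : ∀ τ → classSize τ ≡ classSize (ζ * τ)
  classSize-rotate with ∃-χ≡ζ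
  ... | g , χg≡ζ = classSize-* (χ≡τ⇒nonzero ζ≢0 χg≡ζ) ζ≢0 χg≡ζ

  classSize-1≡ζ : classSize 1# ≡ classSize ζ
  classSize-1≡ζ = trans (classSize-rotate 1#) (cong classSize (*-identityʳ ζ))

  classSize-ζ≡ζ² : classSize ζ ≡ classSize ζ²
  classSize-ζ≡ζ² = trans (classSize-rotate ζ) (cong classSize ζ*ζ≡ζ²)

  classSize-1≡s : classSize 1# ≡ s
  classSize-1≡s = ℕP.*-cancelʳ-≡ _ _ 3 (ℕP.suc-injective (begin
    suc (N ℕ.* 3)                  ≡⟨ three-times N ⟩
    1 ℕ.+ 1 ℕ.* N ℕ.+ 1 ℕ.* N ℕ.+ 1 ℕ.* N
      ≡⟨ cong₂ (λ a b → 1 ℕ.+ 1 ℕ.* N ℕ.+ 1 ℕ.* a ℕ.+ 1 ℕ.* b) classSize-1≡ζ (trans classSize-1≡ζ classSize-ζ≡ζ²) ⟩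
    1 ℕ.+ 1 ℕ.* N ℕ.+ 1 ℕ.* classSize ζ ℕ.+ 1 ℕ.* classSize ζ² ≡⟨ sym (∑-classWeight 1 1 1 1) ⟩
    ∑ (classWeight 1 1 1 1 ∘ from)  ≡⟨ ∑-cong {q} (classWeight-partition ∘ from) ⟩
    ∑ {q} (λ _ → 1)                ≡⟨ ∑-ones q ⟩
    q                              ≡⟨ q≡1+s*3 ⟩
    suc (s ℕ.* 3)                  ∎))
    where
      open ≡-Reasoning
      N : ℕ
      N = classSize 1#
      three-times : ∀ n → suc (n ℕ.* 3) ≡ 1 ℕ.+ 1 ℕ.* n ℕ.+ 1 ℕ.* n ℕ.+ 1 ℕ.* n
      three-times = ℕSolver.solve-∀

  classSize-ζ≡s : classSize ζ ≡ s
  classSize-ζ≡s = trans (sym classSize-1≡ζ) classSize-1≡s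

  classSize-ζ²≡s : classSize ζ² ≡ s
  classSize-ζ²≡s = trans (sym classSize-ζ≡ζ²) classSize-ζ≡s

  ∑-classWeight-s : ∀ w₀ w₁ w₂ w₃ → ∑ (classWeight w₀ w₁ w₂ w₃ ∘ from) ≡ w₀ ℕ.+ w₁ ℕ.* s ℕ.+ w₂ ℕ.* s ℕ.+ w₃ ℕ.* s
  ∑-classWeight-s w₀ w₁ w₂ w₃ = trans (∑-classWeight w₀ w₁ w₂ w₃)
    (cong₂ ℕ._+_ (cong₂ ℕ._+_ (cong ((w₀ ℕ.+_) ∘ (w₁ ℕ.*_)) classSize-1≡s) (cong (w₂ ℕ.*_) classSize-ζ≡s))
                 (cong (w₃ ℕ.*_) classSize-ζ²≡s))

module Trinomial {q : ℕ} (F : FiniteField q) (ζ : FiniteField.Carrier F)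
                 (ζ-order3 : FiniteField.HasOrder F ζ 3) (s : ℕ) (q≡1+s*3 : q ≡ suc (s ℕ.* 3))
                 (t : FiniteField.Carrier F) (t*3≡1 : FiniteField._*_ F t (FiniteField.three F) ≡ FiniteField.1# F) where
  open FiniteFieldProperties F
  open MinimalPeriods F
  open CubeRootsOfUnity F ζ ζ-order3
  open CubicCharacter F ζ ζ-order3 s q≡1+s*3

  trinomial : Carrier → Carrier → Carrier → Carrier → Carrier
  trinomial α β γ x = t * (α + β * ζ + γ * (ζ ^ 2)) * (x ^ ((2 ℕ.* q ℕ.+ 1) / 3))
                    + t * (α + β * (ζ ^ 2) + γ * ζ) * (x ^ ((q ℕ.+ 2) / 3))
                    + t * (α + β + γ) * x

  multiplier : Carrier → Carrier → Carrier → Carrier → Carrier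
  multiplier α β γ τ = t * (α + β * ζ + γ * (ζ ^ 2)) * (τ * τ) + t * (α + β * (ζ ^ 2) + γ * ζ) * τ + t * (α + β + γ)

  [2q+1]/3≡2s+1 : (2 ℕ.* q ℕ.+ 1) / 3 ≡ suc (s ℕ.+ s)
  [2q+1]/3≡2s+1 = trans (cong (λ n → (2 ℕ.* n ℕ.+ 1) / 3) q≡1+s*3)
                        (trans (cong (_/ 3) (multiple-of-3 s)) (ℕD.m*n/n≡m (suc (s ℕ.+ s)) 3))
    where
      multiple-of-3 : ∀ s → 2 ℕ.* suc (s ℕ.* 3) ℕ.+ 1 ≡ suc (s ℕ.+ s) ℕ.* 3
      multiple-of-3 = ℕSolver.solve-∀

  [q+2]/3≡s+1 : (q ℕ.+ 2) / 3 ≡ suc s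
  [q+2]/3≡s+1 = trans (cong (λ n → (n ℕ.+ 2) / 3) q≡1+s*3)
                      (trans (cong (_/ 3) (multiple-of-3 s)) (ℕD.m*n/n≡m (suc s) 3))
    where
      multiple-of-3 : ∀ s → suc (s ℕ.* 3) ℕ.+ 2 ≡ suc s ℕ.* 3
      multiple-of-3 = ℕSolver.solve-∀

  trinomial-χ : ∀ α β γ x → trinomial α β γ x ≡ multiplier α β γ (χ x) * x
  trinomial-χ α β γ x = begin
    trinomial α β γ x                                 ≡⟨ cong₂ (λ m n → A * x ^ m + B * x ^ n + C * x) [2q+1]/3≡2s+1 [q+2]/3≡s+1 ⟩
    A * (x * x ^ (s ℕ.+ s)) + B * (x * χ x) + C * x   ≡⟨ cong (λ y → A * (x * y) + B * (x * χ x) + C * x) (^-homo-* x s s) ⟩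
    A * (x * (χ x * χ x)) + B * (x * χ x) + C * x
      ≡⟨ solve 5 (λ a b c x X → a :* (x :* (X :* X)) :+ b :* (x :* X) :+ c :* x := (a :* (X :* X) :+ b :* X :+ c) :* x)
               refl A B C x (χ x) ⟩
    multiplier α β γ (χ x) * x                        ∎
    where
      open ≡-Reasoning
      A B C : Carrier
      A = t * (α + β * ζ + γ * ζ²)
      B = t * (α + β * ζ² + γ * ζ)
      C = t * (α + β + γ)

  -- Discrete Fourier inversion over the cube roots of unity: on the class χ x = τ the
  -- multiplier picks out one of α, β, γ because Φ₃ vanishes at ζ and ζ² and is 3 at 1.
  multiplier-Φ₃ : ∀ α β γ τ → multiplier α β γ τ ≡ t * (α * Φ₃ τ + β * Φ₃ (ζ² * τ) + γ * Φ₃ (ζ * τ))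
  multiplier-Φ₃ α β γ τ = +-cancelʳ (t * β * ζ * (τ * τ)) _ _ (begin
    multiplier α β γ τ + t * β * ζ * (τ * τ)
      ≡⟨ cong (multiplier α β γ τ +_) (trans (sym (*-identityʳ _)) (cong (t * β * ζ * (τ * τ) *_) (sym ζ³≡1))) ⟩
    multiplier α β γ τ + t * β * ζ * (τ * τ) * ζ ^ 3
      ≡⟨ solve 6 (λ t α β γ z τ →
           let z² = z :* (z :* con 1)
               Φ = λ y → con 1 :+ y :+ y :* y
           in t :* (α :+ β :* z :+ γ :* z²) :* (τ :* τ) :+ t :* (α :+ β :* z² :+ γ :* z) :* τ :+ t :* (α :+ β :+ γ)
              :+ t :* β :* z :* (τ :* τ) :* (z :* z²)
           := t :* (α :* Φ τ :+ β :* Φ (z² :* τ) :+ γ :* Φ (z :* τ)) :+ t :* β :* z :* (τ :* τ))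
         refl t α β γ ζ τ ⟩
    t * (α * Φ₃ τ + β * Φ₃ (ζ² * τ) + γ * Φ₃ (ζ * τ)) + t * β * ζ * (τ * τ) ∎)
    where open ≡-Reasoning

  private
    multiplier-at : ∀ α β γ τ {X Y Z} → Φ₃ τ ≡ X → Φ₃ (ζ² * τ) ≡ Y → Φ₃ (ζ * τ) ≡ Z →
                    multiplier α β γ τ ≡ t * (α * X + β * Y + γ * Z)
    multiplier-at α β γ τ refl refl refl = multiplier-Φ₃ α β γ τ

    Three : ∀ {n} → Polynomial n
    Three = con 1 :+ con 1 :+ con 1

    t*three-cancel : ∀ x → x * (t * three) ≡ x
    t*three-cancel x = trans (cong (x *_) t*3≡1) (*-identityʳ x)

  multiplier-1 : ∀ α β γ → multiplier α β γ 1# ≡ α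
  multiplier-1 α β γ = begin
    multiplier α β γ 1#                ≡⟨ multiplier-at α β γ 1# Φ₃-1 (trans (cong Φ₃ (*-identityʳ ζ²)) Φ₃-ζ²)
                                                                    (trans (cong Φ₃ (*-identityʳ ζ)) Φ₃-ζ) ⟩
    t * (α * three + β * 0# + γ * 0#)  ≡⟨ solve 4 (λ t α β γ → t :* (α :* Three :+ β :* con 0 :+ γ :* con 0)
                                                              := α :* (t :* Three)) refl t α β γ ⟩
    α * (t * three)                    ≡⟨ t*three-cancel α ⟩
    α                                  ∎
    where open ≡-Reasoning

  multiplier-ζ : ∀ α β γ → multiplier α β γ ζ ≡ β
  multiplier-ζ α β γ = begin
    multiplier α β γ ζ                 ≡⟨ multiplier-at α β γ ζ Φ₃-ζ (trans (cong Φ₃ ζ²*ζ≡1) Φ₃-1)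
                                                                  (trans (cong Φ₃ ζ*ζ≡ζ²) Φ₃-ζ²) ⟩
    t * (α * 0# + β * three + γ * 0#)  ≡⟨ solve 4 (λ t α β γ → t :* (α :* con 0 :+ β :* Three :+ γ :* con 0)
                                                              := β :* (t :* Three)) refl t α β γ ⟩
    β * (t * three)                    ≡⟨ t*three-cancel β ⟩
    β                                  ∎
    where open ≡-Reasoning

  multiplier-ζ² : ∀ α β γ → multiplier α β γ ζ² ≡ γ
  multiplier-ζ² α β γ = begin
    multiplier α β γ ζ²                ≡⟨ multiplier-at α β γ ζ² Φ₃-ζ² (trans (cong Φ₃ ζ²*ζ²≡ζ) Φ₃-ζ)
                                                                   (trans (cong Φ₃ ζ³≡1) Φ₃-1) ⟩
    t * (α * 0# + β * 0# + γ * three)  ≡⟨ solve 4 (λ t α β γ → t :* (α :* con 0 :+ β :* con 0 :+ γ :* Three)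
                                                              := γ :* (t :* Three)) refl t α β γ ⟩
    γ * (t * three)                    ≡⟨ t*three-cancel γ ⟩
    γ                                  ∎
    where open ≡-Reasoning

  trinomial-0 : ∀ α β γ → trinomial α β γ 0# ≡ 0#
  trinomial-0 α β γ = trans (trinomial-χ α β γ 0#) (zeroʳ _)

  trinomial-1 : ∀ α β γ {x} → χ x ≡ 1# → trinomial α β γ x ≡ α * x
  trinomial-1 α β γ {x} χx≡1 =
    trans (trinomial-χ α β γ x) (cong (_* x) (trans (cong (multiplier α β γ) χx≡1) (multiplier-1 α β γ)))

  trinomial-ζ : ∀ α β γ {x} → χ x ≡ ζ → trinomial α β γ x ≡ β * x
  trinomial-ζ α β γ {x} χx≡ζ =
    trans (trinomial-χ α β γ x) (cong (_* x) (trans (cong (multiplier α β γ) χx≡ζ) (multiplier-ζ α β γ)))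

  trinomial-ζ² : ∀ α β γ {x} → χ x ≡ ζ² → trinomial α β γ x ≡ γ * x
  trinomial-ζ² α β γ {x} χx≡ζ² =
    trans (trinomial-χ α β γ x) (cong (_* x) (trans (cong (multiplier α β γ) χx≡ζ²) (multiplier-ζ² α β γ)))

  private
    undo-scaling : ∀ {f g : Carrier → Carrier} {x a a'} → f x ≡ a * x → g (a * x) ≡ a' * (a * x) → a' * a ≡ 1# → g (f x) ≡ x
    undo-scaling {f} {g} {x} {a} {a'} fx≡ax gax≡a'ax a'a≡1 = begin
      g (f x)        ≡⟨ cong g fx≡ax ⟩
      g (a * x)      ≡⟨ gax≡a'ax ⟩
      a' * (a * x)   ≡⟨ sym (*-assoc a' a x) ⟩
      (a' * a) * x   ≡⟨ cong (_* x) a'a≡1 ⟩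
      1# * x         ≡⟨ *-identityˡ x ⟩
      x              ∎
      where open ≡-Reasoning

  trinomial-inverse : ∀ {u v w u' v' w'} → χ u ≡ 1# → χ v ≡ 1# → χ w ≡ 1# →
                      u' * u ≡ 1# → v' * v ≡ 1# → w' * w ≡ 1# → ∀ x → trinomial u' v' w' (trinomial u v w x) ≡ x
  trinomial-inverse {u} {v} {w} {u'} {v'} {w'} χu≡1 χv≡1 χw≡1 u'u≡1 v'v≡1 w'w≡1 x with χ-values x
  ... | inj₁ x≡0 = begin
    trinomial u' v' w' (trinomial u v w x)   ≡⟨ cong (trinomial u' v' w' ∘ trinomial u v w) x≡0 ⟩
    trinomial u' v' w' (trinomial u v w 0#)  ≡⟨ cong (trinomial u' v' w') (trinomial-0 u v w) ⟩
    trinomial u' v' w' 0#                    ≡⟨ trinomial-0 u' v' w' ⟩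
    0#                                       ≡⟨ sym x≡0 ⟩
    x                                        ∎
    where open ≡-Reasoning
  ... | inj₂ (inj₁ χx≡1) = undo-scaling {trinomial u v w} {trinomial u' v' w'} (trinomial-1 u v w χx≡1) (trinomial-1 u' v' w' (trans (χ-*-kernel χu≡1 x) χx≡1)) u'u≡1
  ... | inj₂ (inj₂ (inj₁ χx≡ζ)) = undo-scaling {trinomial u v w} {trinomial u' v' w'} (trinomial-ζ u v w χx≡ζ) (trinomial-ζ u' v' w' (trans (χ-*-kernel χv≡1 x) χx≡ζ)) v'v≡1
  ... | inj₂ (inj₂ (inj₂ χx≡ζ²)) = undo-scaling {trinomial u v w} {trinomial u' v' w'} (trinomial-ζ² u v w χx≡ζ²) (trinomial-ζ² u' v' w' (trans (χ-*-kernel χw≡1 x) χx≡ζ²)) w'w≡1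

  module _ {u v w : Carrier} {m₀ m₁ m₂ : ℕ} (u-order : HasOrder u m₀) (v-order : HasOrder v m₁) (w-order : HasOrder w m₂)
           (m₀∣s : m₀ ∣ s) (m₁∣s : m₁ ∣ s) (m₂∣s : m₂ ∣ s) where

    private
      σ : Carrier → Carrier
      σ = trinomial u v w

      minimalPeriod-on-class : ∀ {y m τ} → HasOrder y m → m ∣ s → τ ≢ 0# → (∀ z → χ z ≡ τ → σ z ≡ y * z) →
                               ∀ {x} → χ x ≡ τ → IsMinimalPeriod σ x m
      minimalPeriod-on-class y-order m∣s τ≢0 σ≡y* χx≡τ = minimalPeriod-scaling (χ≡τ⇒nonzero τ≢0 χx≡τ) y-order
        (iter-on-invariant _ σ≡y* (λ z χz≡τ → trans (χ-*-kernel (χ≡1-of-order y-order m∣s) z) χz≡τ) χx≡τ)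

    indicator-hasPeriod-trinomial : ∀ L → .⦃ _ : NonZero L ⦄ → ∀ x →
      indicator (hasPeriod σ L x BoolP.≟ true) ≡ classWeight (δ 1 L) (δ m₀ L) (δ m₁ L) (δ m₂ L) x
    indicator-hasPeriod-trinomial L x with χ-values x
    ... | inj₁ x≡0 = trans
      (indicator-hasPeriod (minimalPeriod-fixed (trans (cong σ x≡0) (trans (trinomial-0 u v w) (sym x≡0)))) L)
      (sym (classWeight-0 (δ 1 L) (δ m₀ L) (δ m₁ L) (δ m₂ L) x≡0))
    ... | inj₂ (inj₁ χx≡1) = trans
      (indicator-hasPeriod (minimalPeriod-on-class u-order m₀∣s 1≢0 (λ _ → trinomial-1 u v w) χx≡1) L)
      (sym (classWeight-1 (δ 1 L) (δ m₀ L) (δ m₁ L) (δ m₂ L) χx≡1))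
    ... | inj₂ (inj₂ (inj₁ χx≡ζ)) = trans
      (indicator-hasPeriod (minimalPeriod-on-class v-order m₁∣s ζ≢0 (λ _ → trinomial-ζ u v w) χx≡ζ) L)
      (sym (classWeight-ζ (δ 1 L) (δ m₀ L) (δ m₁ L) (δ m₂ L) χx≡ζ))
    ... | inj₂ (inj₂ (inj₂ χx≡ζ²)) = trans
      (indicator-hasPeriod (minimalPeriod-on-class w-order m₂∣s ζ²≢0 (λ _ → trinomial-ζ² u v w) χx≡ζ²) L)
      (sym (classWeight-ζ² (δ 1 L) (δ m₀ L) (δ m₁ L) (δ m₂ L) χx≡ζ²))

    numCycles-trinomial : ∀ L → .⦃ _ : NonZero L ⦄ →
      numCycles σ L ≡ (δ 1 L ℕ.+ δ m₀ L ℕ.* s ℕ.+ δ m₁ L ℕ.* s ℕ.+ δ m₂ L ℕ.* s) / L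
    numCycles-trinomial L = cong (_/ L) (begin
      length (filter (λ x → hasPeriod σ L x BoolP.≟ true) elements)   ≡⟨ count-elements (λ x → hasPeriod σ L x BoolP.≟ true) ⟩
      ∑ (λ i → indicator (hasPeriod σ L (from i) BoolP.≟ true))        ≡⟨ ∑-cong {q} (indicator-hasPeriod-trinomial L ∘ from) ⟩
      ∑ (classWeight (δ 1 L) (δ m₀ L) (δ m₁ L) (δ m₂ L) ∘ from)        ≡⟨ ∑-classWeight-s (δ 1 L) (δ m₀ L) (δ m₁ L) (δ m₂ L) ⟩
      δ 1 L ℕ.+ δ m₀ L ℕ.* s ℕ.+ δ m₁ L ℕ.* s ℕ.+ δ m₂ L ℕ.* s          ∎)
      where open ≡-Reasoning

δ-absorb : ∀ a L k → δ a L ℕ.* (a ℕ.* k) ≡ δ a L ℕ.* k ℕ.* L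
δ-absorb a L k with a ℕ.≟ L
... | yes refl = ℕSolver.solve (a ∷ k ∷ [])
... | no _ = refl

cycleCount-arith : ∀ L .⦃ _ : NonZero L ⦄ {s} m₀ m₁ m₂ k₀ k₁ k₂ → s ≡ m₀ ℕ.* k₀ → s ≡ m₁ ℕ.* k₁ → s ≡ m₂ ℕ.* k₂ →
  (δ 1 L ℕ.+ δ m₀ L ℕ.* s ℕ.+ δ m₁ L ℕ.* s ℕ.+ δ m₂ L ℕ.* s) / L ≡ δ 1 L ℕ.+ δ m₀ L ℕ.* k₀ ℕ.+ δ m₁ L ℕ.* k₁ ℕ.+ δ m₂ L ℕ.* k₂
cycleCount-arith L {s} m₀ m₁ m₂ k₀ k₁ k₂ s≡₀ s≡₁ s≡₂ = trans (cong (_/ L) numerator) (ℕD.m*n/n≡m _ L)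
  where
    open ≡-Reasoning
    absorb : ∀ {mᵢ kᵢ} → s ≡ mᵢ ℕ.* kᵢ → δ mᵢ L ℕ.* s ≡ δ mᵢ L ℕ.* kᵢ ℕ.* L
    absorb {mᵢ} {kᵢ} s≡ = trans (cong (δ mᵢ L ℕ.*_) s≡) (δ-absorb mᵢ L kᵢ)
    factor-L : ∀ a b c e L → a ℕ.* 1 ℕ.* L ℕ.+ b ℕ.* L ℕ.+ c ℕ.* L ℕ.+ e ℕ.* L ≡ (a ℕ.+ b ℕ.+ c ℕ.+ e) ℕ.* L
    factor-L = ℕSolver.solve-∀
    numerator : δ 1 L ℕ.+ δ m₀ L ℕ.* s ℕ.+ δ m₁ L ℕ.* s ℕ.+ δ m₂ L ℕ.* s
                ≡ (δ 1 L ℕ.+ δ m₀ L ℕ.* k₀ ℕ.+ δ m₁ L ℕ.* k₁ ℕ.+ δ m₂ L ℕ.* k₂) ℕ.* L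
    numerator = begin
      δ 1 L ℕ.+ δ m₀ L ℕ.* s ℕ.+ δ m₁ L ℕ.* s ℕ.+ δ m₂ L ℕ.* s
        ≡⟨ cong₂ ℕ._+_ (cong₂ ℕ._+_ (cong₂ ℕ._+_ (trans (sym (ℕP.*-identityʳ (δ 1 L))) (δ-absorb 1 L 1)) (absorb {m₀} s≡₀)) (absorb {m₁} s≡₁)) (absorb {m₂} s≡₂) ⟩
      δ 1 L ℕ.* 1 ℕ.* L ℕ.+ δ m₀ L ℕ.* k₀ ℕ.* L ℕ.+ δ m₁ L ℕ.* k₁ ℕ.* L ℕ.+ δ m₂ L ℕ.* k₂ ℕ.* L
        ≡⟨ factor-L (δ 1 L) (δ m₀ L ℕ.* k₀) (δ m₁ L ℕ.* k₁) (δ m₂ L ℕ.* k₂) L ⟩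
      (δ 1 L ℕ.+ δ m₀ L ℕ.* k₀ ℕ.+ δ m₁ L ℕ.* k₁ ℕ.+ δ m₂ L ℕ.* k₂) ℕ.* L ∎

third-of-product : ∀ {s m d n k} → s ℕ.* 3 ≡ m ℕ.* d → d % 3 ≡ 0 → m ≡ n ℕ.* k → s ≡ k ℕ.* ((d ℕ.* n) / 3)
third-of-product {s} {m} {d} {n} {k} s*3≡m*d d%3≡0 m≡n*k = begin
    s                       ≡⟨ ℕP.*-cancelʳ-≡ s (m ℕ.* d') 3 (trans s*3≡m*d (trans (cong (m ℕ.*_) d≡d'*3) (sym (ℕP.*-assoc m d' 3)))) ⟩
    m ℕ.* d'                ≡⟨ cong (ℕ._* d') m≡n*k ⟩
    n ℕ.* k ℕ.* d'          ≡⟨ rearrange₁ n k d' ⟩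
    k ℕ.* (n ℕ.* d')        ≡⟨ cong (k ℕ.*_) (sym (ℕD.m*n/n≡m (n ℕ.* d') 3)) ⟩
    k ℕ.* ((n ℕ.* d' ℕ.* 3) / 3) ≡⟨ cong (λ x → k ℕ.* (x / 3)) (trans (rearrange₂ n d') (cong (ℕ._* n) (sym d≡d'*3))) ⟩
    k ℕ.* ((d ℕ.* n) / 3)   ∎
  where
    open ≡-Reasoning
    d' : ℕ
    d' = d / 3
    d≡d'*3 : d ≡ d' ℕ.* 3
    d≡d'*3 = trans (ℕD.m≡m%n+[m/n]*n d 3) (cong (ℕ._+ d' ℕ.* 3) d%3≡0)
    rearrange₁ : ∀ a b c → a ℕ.* b ℕ.* c ≡ b ℕ.* (a ℕ.* c)
    rearrange₁ = ℕSolver.solve-∀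
    rearrange₂ : ∀ a b → a ℕ.* b ℕ.* 3 ≡ b ℕ.* 3 ℕ.* a
    rearrange₂ = ℕSolver.solve-∀

mainTheorem4 : (q : ℕ) (F : FiniteField q) → let open FiniteField F in
  (∃₂ λ p k → Prime p × p % 2 ≡ 1 × 1 ≤ k × q ≡ p ℕ.^ k) →
  q % 3 ≡ 1 →
  (ζ : Carrier) → HasOrder ζ 3 →
  (m d : ℕ) → 1 ≤ m → 1 ≤ d → q ∸ 1 ≡ m ℕ.* d → d % 3 ≡ 0 →
  (u v w : Carrier) (m₀ m₁ m₂ n₀ n₁ n₂ : ℕ) →
  HasOrder u m₀ → HasOrder v m₁ → HasOrder w m₂ →
  m ≡ n₀ ℕ.* m₀ → m ≡ n₁ ℕ.* m₁ → m ≡ n₂ ℕ.* m₂ →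
  (t : Carrier) → t * three ≡ 1# →
  (u' v' w' : Carrier) → u * u' ≡ 1# → v * v' ≡ 1# → w * w' ≡ 1# →
  let a = t * (u + v * ζ + w * (ζ ^ 2))
      b = t * (u + v * (ζ ^ 2) + w * ζ)
      c = t * (u + v + w)
      f = λ x → a * (x ^ ((2 ℕ.* q ℕ.+ 1) / 3)) + b * (x ^ ((q ℕ.+ 2) / 3)) + c * x
      a' = t * (u' + v' * ζ + w' * (ζ ^ 2))
      b' = t * (u' + v' * (ζ ^ 2) + w' * ζ)
      c' = t * (u' + v' + w')
      g = λ x → a' * (x ^ ((2 ℕ.* q ℕ.+ 1) / 3)) + b' * (x ^ ((q ℕ.+ 2) / 3)) + c' * x
  in Bijective _≡_ _≡_ f
     × (∀ L → .{{_ : NonZero L}} →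
          numCycles f L ≡ δ 1 L ℕ.+ δ m₀ L ℕ.* ((d ℕ.* n₀) / 3)
                            ℕ.+ δ m₁ L ℕ.* ((d ℕ.* n₁) / 3) ℕ.+ δ m₂ L ℕ.* ((d ℕ.* n₂) / 3))
     × (∀ x → g (f x) ≡ x) × (∀ x → f (g x) ≡ x)
mainTheorem4 q F _ q%3≡1 ζ ζ-order3 m d _ _ q∸1≡m*d d%3≡0 u v w m₀ m₁ m₂ n₀ n₁ n₂ u-order v-order w-order
             m≡n₀*m₀ m≡n₁*m₁ m≡n₂*m₂ t t*3≡1 u' v' w' uu'≡1 vv'≡1 ww'≡1 =
  inverseᵇ⇒bijective (strictlyInverseˡ⇒inverseˡ f f∘g≡id , strictlyInverseʳ⇒inverseʳ f g∘f≡id) ,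
  (λ L → trans (numCycles-trinomial u-order v-order w-order (∣s m₀ n₀ m≡n₀*m₀) (∣s m₁ n₁ m≡n₁*m₁) (∣s m₂ n₂ m≡n₂*m₂) L)
               (cycleCount-arith L m₀ m₁ m₂ _ _ _ (s≡ m₀ n₀ m≡n₀*m₀) (s≡ m₁ n₁ m≡n₁*m₁) (s≡ m₂ n₂ m≡n₂*m₂))) ,
  g∘f≡id , f∘g≡id
  where
    open FiniteFieldProperties F
    s : ℕ
    s = q / 3
    q≡1+s*3 : q ≡ suc (s ℕ.* 3)
    q≡1+s*3 = trans (ℕD.m≡m%n+[m/n]*n q 3) (cong (ℕ._+ s ℕ.* 3) q%3≡1)
    open CubicCharacter F ζ ζ-order3 s q≡1+s*3
    open Trinomial F ζ ζ-order3 s q≡1+s*3 t t*3≡1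
    f g : Carrier → Carrier
    f = trinomial u v w
    g = trinomial u' v' w'
    s≡ : ∀ mᵢ nᵢ → m ≡ nᵢ ℕ.* mᵢ → s ≡ mᵢ ℕ.* ((d ℕ.* nᵢ) / 3)
    s≡ mᵢ nᵢ = third-of-product {n = nᵢ} {k = mᵢ} (trans (cong (_∸ 1) (sym q≡1+s*3)) q∸1≡m*d) d%3≡0
    ∣s : ∀ mᵢ nᵢ → m ≡ nᵢ ℕ.* mᵢ → mᵢ ∣ s
    ∣s mᵢ nᵢ m≡nᵢ*mᵢ = divides ((d ℕ.* nᵢ) / 3) (trans (s≡ mᵢ nᵢ m≡nᵢ*mᵢ) (ℕP.*-comm mᵢ _))
    χu≡1 : χ u ≡ 1#
    χu≡1 = χ≡1-of-order u-order (∣s m₀ n₀ m≡n₀*m₀)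
    χv≡1 : χ v ≡ 1#
    χv≡1 = χ≡1-of-order v-order (∣s m₁ n₁ m≡n₁*m₁)
    χw≡1 : χ w ≡ 1#
    χw≡1 = χ≡1-of-order w-order (∣s m₂ n₂ m≡n₂*m₂)
    g∘f≡id : ∀ x → g (f x) ≡ x
    g∘f≡id = trinomial-inverse χu≡1 χv≡1 χw≡1 (trans (*-comm u' u) uu'≡1) (trans (*-comm v' v) vv'≡1) (trans (*-comm w' w) ww'≡1)
    f∘g≡id : ∀ x → f (g x) ≡ x
    f∘g≡id = trinomial-inverse (χ-inverse χu≡1 uu'≡1) (χ-inverse χv≡1 vv'≡1) (χ-inverse χw≡1 ww'≡1) uu'≡1 vv'≡1 ww'≡1
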